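{- Let $C_n$ be the Catalan numbers, defined by $\sum_{n\ge0}C_nz^n=\frac{1-\sqrt{1-4z}}{2z}$. If the general PI tree is built from the input sequence $g_n=C_{n-1}$ ($n\ge1$), then its row sums are $x_n=C_n$ for all $n\ge1$. Consequently, for all $n\ge1$, \[ C_n=\sum_{m=1}^{n}\sum_{\substack{k_1+\dots+k_m=n\\ k_i\ge1}} C_{k_1-1}\cdots C_{k_m-1} \quad\text{and}\quad C_{n-1}=\sum_{m=1}^{n}(-1)^{m+1}\sum_{\substack{k_1+\dots+k_m=n\\ k_i\ge1}} C_{k_1}\cdots C_{k_m}. \]
   Context: General PI tree: given an input sequence $\{g_n\}_{n\ge1}$, build a binary tree whose nodes are words $g_{i_1}\cdots g_{i_k}$; the root (row 1) is $g_1$, and each node $g_{i_1}g_{i_2}\cdots g_{i_k}$ has the two children $g_1g_{i_1}g_{i_2}\cdots g_{i_k}$ and $g_{i_1+1}g_{i_2}\cdots g_{i_k}$. Row $n$ contains $2^{n-1}$ words, and its row sum $x_n$ is the sum over those words of the products of the numbers $g_i$. -}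

module Defs where

open import Data.Nat using (ℕ; zero; suc; _+_; _*_; _∸_)
open import Data.List using (List; []; _∷_; [_]; map; concatMap; zipWith; reverse; upTo; foldr)
open import Data.Nat.ListAction using (sum; product)
import Data.Integer as ℤ
open ℤ using (ℤ; +_; -1ℤ)

-- The generating function f(z) = (1 - sqrt(1-4z))/(2z) is the unique
-- formal power series with f = 1 + z f^2; comparing coefficients gives
-- C 0 = 1, C (n+1) = Σ_{i=0}^{n} C i * C (n - i).
-- catRev n = [C n, C (n-1), ..., C 0].

catRev : ℕ → List ℕ
catRev zero = 1 ∷ []
catRev (suc n) = sum (zipWith _*_ (catRev n) (reverse (catRev n))) ∷ catRev n

catalan : ℕ → ℕ
catalan n with catRev n
... | []    = 0
... | c ∷ _ = c

-- General PI tree.  A word g_{i1} ... g_{ik} is the list of indices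
-- i1 ∷ ... ∷ ik ∷ [] (indices are ≥ 1; g is given as ℕ → ℕ, g 0 unused).

children : List ℕ → List (List ℕ)
children []       = []
children (i ∷ is) = (1 ∷ i ∷ is) ∷ (suc i ∷ is) ∷ []

-- row n of the tree (rows numbered from 1; row 0 is empty by convention)
row : ℕ → List (List ℕ)
row zero = []
row (suc zero) = [ 1 ∷ [] ]
row (suc (suc n)) = concatMap children (row (suc n))

rowSum : (ℕ → ℕ) → ℕ → ℕ
rowSum g n = sum (map (λ w → product (map g w)) (row n))

compositions : ℕ → ℕ → List (List ℕ)
compositions zero zero = [ [] ]
compositions zero (suc n) = []
compositions (suc m) n =
  concatMap (λ k → map (k ∷_) (compositions m (n ∸ k))) (map suc (upTo n))

oneTo : ℕ → List ℕ
oneTo n = map suc (upTo n)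

firstSum : ℕ → ℕ
firstSum n = sum (map (λ m → sum (map (λ ks → product (map (λ k → catalan (k ∸ 1)) ks))
                                         (compositions m n)))
                      (oneTo n))

sumℤ : List ℤ → ℤ
sumℤ = foldr ℤ._+_ (+ 0)

secondSum : ℕ → ℤ
secondSum n = sumℤ (map (λ m → (-1ℤ ℤ.^ (m + 1)) ℤ.*
                          (+ sum (map (λ ks → product (map catalan ks)) (compositions m n))))
                         (oneTo n))

-- All three identities reduce to one uniqueness principle: a sequence x with
-- x₀ = 1 and x_{n+1} = Σ_{k≤n} a_k x_{n-k} is determined by the coefficients a.
-- The row sums of the PI tree satisfy this with a_k = g_{k+1}, because a node's
-- two children contribute g₁·(its weight) and its weight with the first index
-- raised by one; for g_k = C_{k-1} this is the Catalan recurrence.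
-- Splitting off the first part of a composition shows that Σ_m c^m Σ_{k₁+…+k_m=n}
-- f_{k₁}⋯f_{k_m} satisfies it with a_k = c·f_{k+1}.  For c = 1, f_k = C_{k-1}
-- this is again the Catalan recurrence; for c = -1, f_k = C_k the solution is
-- 1 - z C(z) = 1 / C(z), whose coefficients are 1, -C₀, -C₁, ….
module Submission where

open import Defs
open import Data.Nat using (ℕ; suc; _∸_)
open import Data.Product using (_×_)
open import Relation.Binary.PropositionalEquality using (_≡_)
open import Data.Integer using (+_)

open import Data.Nat using (zero; z≤n; s≤s)
import Data.Nat as ℕ
import Data.Nat.Properties as ℕ
open import Data.Integer using (ℤ; 0ℤ; 1ℤ; -1ℤ; -_; _+_; _*_; _^_)
import Data.Integer.Properties as ℤ
open import Data.Integer.Tactic.RingSolver using (solve-∀)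
open import Data.List using (List; []; _∷_; map; concatMap; zipWith; reverse; applyUpTo; applyDownFrom)
import Data.List.Properties as List
open import Data.Nat.ListAction using (sum; product)
open import Data.Nat.ListAction.Properties using (sum-++)
open import Data.Product using (_,_)
open import Function using (_∘_)
open import Relation.Binary.PropositionalEquality
  using (refl; sym; trans; cong; cong₂; _≗_; module ≡-Reasoning)
open ≡-Reasoning
open import Algebra.Properties.CommutativeSemigroup ℕ.+-commutativeSemigroup
  using () renaming (interchange to ℕ-interchange)
open import Algebra.Properties.CommutativeSemigroup ℤ.+-commutativeSemigroup
  using () renaming (interchange to ℤ-interchange)

∑ : ℕ → (ℕ → ℤ) → ℤ
∑ zero    h = 0ℤ
∑ (suc n) h = h 0 + ∑ n (h ∘ suc)

∑-cong : ∀ n {h h′ : ℕ → ℤ} → (∀ i → i ℕ.< n → h i ≡ h′ i) → ∑ n h ≡ ∑ n h′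
∑-cong zero    eq = refl
∑-cong (suc n) eq = cong₂ _+_ (eq 0 (s≤s z≤n)) (∑-cong n (λ i i<n → eq (suc i) (s≤s i<n)))

∑-zero : ∀ n {h : ℕ → ℤ} → (∀ i → i ℕ.< n → h i ≡ 0ℤ) → ∑ n h ≡ 0ℤ
∑-zero zero    eq = refl
∑-zero (suc n) eq = cong₂ _+_ (eq 0 (s≤s z≤n)) (∑-zero n (λ i i<n → eq (suc i) (s≤s i<n)))

∑-+ : ∀ n (F G : ℕ → ℤ) → ∑ n (λ i → F i + G i) ≡ ∑ n F + ∑ n G
∑-+ zero    F G = refl
∑-+ (suc n) F G = trans (cong (_+_ (F 0 + G 0)) (∑-+ n (F ∘ suc) (G ∘ suc))) (ℤ-interchange (F 0) (G 0) _ _)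

∑-*ˡ : ∀ n c (F : ℕ → ℤ) → ∑ n (λ i → c * F i) ≡ c * ∑ n F
∑-*ˡ zero    c F = sym (ℤ.*-zeroʳ c)
∑-*ˡ (suc n) c F =
  trans (cong (_+_ (c * F 0)) (∑-*ˡ n c (F ∘ suc))) (sym (ℤ.*-distribˡ-+ c (F 0) _))

∑-swap : ∀ m n (F : ℕ → ℕ → ℤ) → ∑ m (λ i → ∑ n (F i)) ≡ ∑ n (λ j → ∑ m (λ i → F i j))
∑-swap zero    n F = sym (∑-zero n (λ _ _ → refl))
∑-swap (suc m) n F =
  trans (cong (_+_ (∑ n (F 0))) (∑-swap m n (F ∘ suc))) (sym (∑-+ n (F 0) _))

∑-vanishing-tail : ∀ n d (h : ℕ → ℤ) → (∀ k → n ℕ.≤ k → h k ≡ 0ℤ) → ∑ (n ℕ.+ d) h ≡ ∑ n h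
∑-vanishing-tail zero    d h tail = ∑-zero d (λ i _ → tail i z≤n)
∑-vanishing-tail (suc n) d h tail =
  cong (_+_ (h 0)) (∑-vanishing-tail n d (h ∘ suc) (λ k n≤k → tail (suc k) (s≤s n≤k)))

∑-last : ∀ n (h : ℕ → ℤ) → ∑ (suc n) h ≡ ∑ n h + h n
∑-last zero    h = trans (ℤ.+-identityʳ (h 0)) (sym (ℤ.+-identityˡ (h 0)))
∑-last (suc n) h = trans (cong (_+_ (h 0)) (∑-last n (h ∘ suc))) (sym (ℤ.+-assoc (h 0) _ _))

sumℤ-applyUpTo : ∀ (u : ℕ → ℤ) n → sumℤ (applyUpTo u n) ≡ ∑ n u
sumℤ-applyUpTo u zero    = refl
sumℤ-applyUpTo u (suc n) = cong (_+_ (u 0)) (sumℤ-applyUpTo (u ∘ suc) n)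

+-sum : ∀ ms → + sum ms ≡ sumℤ (map +_ ms)
+-sum []       = refl
+-sum (m ∷ ms) = trans (ℤ.pos-+ m (sum ms)) (cong (_+_ (+ m)) (+-sum ms))

+-sum-applyUpTo : ∀ (u : ℕ → ℕ) n → + sum (applyUpTo u n) ≡ ∑ n (λ i → + u i)
+-sum-applyUpTo u n =
  trans (+-sum (applyUpTo u n)) (trans (cong sumℤ (List.map-applyUpTo u +_ n)) (sumℤ-applyUpTo _ n))

sumℤ-map-oneTo : ∀ (h : ℕ → ℤ) n → sumℤ (map h (oneTo n)) ≡ ∑ n (h ∘ suc)
sumℤ-map-oneTo h n =
  trans (cong (sumℤ ∘ map h) (List.map-upTo suc n))
        (trans (cong sumℤ (List.map-applyUpTo suc h n)) (sumℤ-applyUpTo _ n))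

+-sum-map-oneTo : ∀ (h : ℕ → ℕ) n → + sum (map h (oneTo n)) ≡ ∑ n (λ i → + h (suc i))
+-sum-map-oneTo h n =
  trans (cong (+_ ∘ sum ∘ map h) (List.map-upTo suc n))
        (trans (cong (+_ ∘ sum) (List.map-applyUpTo suc h n)) (+-sum-applyUpTo _ n))

+-*-+ : ∀ a b c → + (a ℕ.* b ℕ.+ c) ≡ + a * + b + + c
+-*-+ a b c = trans (ℤ.pos-+ (a ℕ.* b) c) (cong (_+ + c) (ℤ.pos-* a b))

∸-suc : ∀ {n k} → k ℕ.< n → n ∸ k ≡ suc (n ∸ suc k)
∸-suc {suc n} {zero}  _         = refl
∸-suc {suc n} {suc k} (s≤s k<n) = ∸-suc k<n

module _ {A : Set} where

  sum-concatMap : ∀ (F : A → List ℕ) xs → sum (concatMap F xs) ≡ sum (map (sum ∘ F) xs)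
  sum-concatMap F []       = refl
  sum-concatMap F (x ∷ xs) = trans (sum-++ (F x) _) (cong (sum (F x) ℕ.+_) (sum-concatMap F xs))

  sum-map-concatMap : ∀ (h : List ℕ → ℕ) (F : A → List (List ℕ)) xs →
    sum (map h (concatMap F xs)) ≡ sum (map (λ x → sum (map h (F x))) xs)
  sum-map-concatMap h F xs =
    trans (cong sum (List.map-concatMap h F xs)) (sum-concatMap (map h ∘ F) xs)

  sum-map-*ˡ : ∀ a (h : A → ℕ) xs → sum (map (λ x → a ℕ.* h x) xs) ≡ a ℕ.* sum (map h xs)
  sum-map-*ˡ a h []       = sym (ℕ.*-zeroʳ a)
  sum-map-*ˡ a h (x ∷ xs) =
    trans (cong ((a ℕ.* h x) ℕ.+_) (sum-map-*ˡ a h xs)) (sym (ℕ.*-distribˡ-+ a (h x) _))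

  sum-map-+ : ∀ (F G : A → ℕ) xs →
    sum (map (λ x → F x ℕ.+ G x) xs) ≡ sum (map F xs) ℕ.+ sum (map G xs)
  sum-map-+ F G []       = refl
  sum-map-+ F G (x ∷ xs) =
    trans (cong ((F x ℕ.+ G x) ℕ.+_) (sum-map-+ F G xs)) (ℕ-interchange (F x) (G x) _ _)

record ConvolutionRecurrence (a x : ℕ → ℤ) : Set where
  constructor convolution
  field
    recurrence : ∀ n → x (suc n) ≡ ∑ (suc n) (λ k → a k * x (n ∸ k))

open ConvolutionRecurrence

convolution-unique : ∀ {a b x y : ℕ → ℤ} → a ≗ b → x 0 ≡ y 0 →
  ConvolutionRecurrence a x → ConvolutionRecurrence b y → x ≗ y
convolution-unique {a} {b} {x} {y} a≗b x₀≡y₀ (convolution recx) (convolution recy) n =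
  agreeUpTo n n ℕ.≤-refl
  where
  agreeUpTo : ∀ n k → k ℕ.≤ n → x k ≡ y k
  agreeUpTo n       zero    _         = x₀≡y₀
  agreeUpTo (suc n) (suc k) (s≤s k≤n) = begin
    x (suc k)
      ≡⟨ recx k ⟩
    ∑ (suc k) (λ i → a i * x (k ∸ i))
      ≡⟨ ∑-cong (suc k) (λ i _ → cong₂ _*_ (a≗b i) (agreeUpTo n (k ∸ i) (k∸i≤n i))) ⟩
    ∑ (suc k) (λ i → b i * y (k ∸ i))
      ≡⟨ sym (recy k) ⟩
    y (suc k) ∎
    where
    k∸i≤n : ∀ i → k ∸ i ℕ.≤ n
    k∸i≤n i = ℕ.≤-trans (ℕ.m∸n≤m k i) k≤n

applyDownFrom-applyUpTo : ∀ {A : Set} (f : ℕ → A) n →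
  applyDownFrom f n ≡ applyUpTo (λ i → f (n ∸ suc i)) n
applyDownFrom-applyUpTo f zero    = refl
applyDownFrom-applyUpTo f (suc n) = cong (f n ∷_) (applyDownFrom-applyUpTo f n)

zipWith-applyUpTo : ∀ {A B C : Set} (_⊕_ : A → B → C) u v n →
  zipWith _⊕_ (applyUpTo u n) (applyUpTo v n) ≡ applyUpTo (λ i → u i ⊕ v i) n
zipWith-applyUpTo _⊕_ u v zero    = refl
zipWith-applyUpTo _⊕_ u v (suc n) = cong (u 0 ⊕ v 0 ∷_) (zipWith-applyUpTo _⊕_ (u ∘ suc) (v ∘ suc) n)

catRev-applyDownFrom : ∀ n → catRev n ≡ applyDownFrom catalan (suc n)
catRev-applyDownFrom zero    = refl
catRev-applyDownFrom (suc n) = cong (catalan (suc n) ∷_) (catRev-applyDownFrom n)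

catalan-recurrence : ConvolutionRecurrence (+_ ∘ catalan) (+_ ∘ catalan)
catalan-recurrence .recurrence n = begin
  + sum (zipWith ℕ._*_ (catRev n) (reverse (catRev n)))
    ≡⟨ cong (λ l → + sum (zipWith ℕ._*_ l (reverse l))) (catRev-applyDownFrom n) ⟩
  + sum (zipWith ℕ._*_ (applyDownFrom catalan (suc n)) (reverse (applyDownFrom catalan (suc n))))
    ≡⟨ cong₂ (λ l r → + sum (zipWith ℕ._*_ l r))
             (applyDownFrom-applyUpTo catalan (suc n)) (List.reverse-applyDownFrom catalan (suc n)) ⟩
  + sum (zipWith ℕ._*_ (applyUpTo (λ i → catalan (n ∸ i)) (suc n)) (applyUpTo catalan (suc n)))
    ≡⟨ cong (+_ ∘ sum) (zipWith-applyUpTo ℕ._*_ (λ i → catalan (n ∸ i)) catalan (suc n)) ⟩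
  + sum (applyUpTo (λ i → catalan (n ∸ i) ℕ.* catalan i) (suc n))
    ≡⟨ +-sum-applyUpTo (λ i → catalan (n ∸ i) ℕ.* catalan i) (suc n) ⟩
  ∑ (suc n) (λ i → + (catalan (n ∸ i) ℕ.* catalan i))
    ≡⟨ ∑-cong (suc n) (λ i _ → trans (ℤ.pos-* (catalan (n ∸ i)) (catalan i))
                                     (ℤ.*-comm (+ catalan (n ∸ i)) (+ catalan i))) ⟩
  ∑ (suc n) (λ i → + catalan i * + catalan (n ∸ i)) ∎

module PITree (g : ℕ → ℕ) where

  -- The empty word never occurs in the tree; giving it weight 0 makes
  -- shiftedWeight-children hold for every word.
  shiftedWeight : ℕ → List ℕ → ℕ
  shiftedWeight j []       = 0
  shiftedWeight j (i ∷ is) = g (j ℕ.+ i) ℕ.* product (map g is)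

  shiftedRowSum : ℕ → ℕ → ℕ
  shiftedRowSum n j = sum (map (shiftedWeight j) (row n))

  -- x₀ := 1, so that the row sums satisfy the convolution recurrence from n = 0.
  rowSeries : ℕ → ℤ
  rowSeries zero    = 1ℤ
  rowSeries (suc n) = + rowSum g (suc n)

  shiftedWeight-children : ∀ j w →
    sum (map (shiftedWeight j) (children w)) ≡ g (j ℕ.+ 1) ℕ.* shiftedWeight 0 w ℕ.+ shiftedWeight (suc j) w
  shiftedWeight-children j []       = sym (trans (ℕ.+-identityʳ _) (ℕ.*-zeroʳ (g (j ℕ.+ 1))))
  shiftedWeight-children j (i ∷ is) =
    cong ((g (j ℕ.+ 1) ℕ.* (g i ℕ.* product (map g is))) ℕ.+_)
         (trans (ℕ.+-identityʳ _) (cong (λ t → g t ℕ.* product (map g is)) (ℕ.+-suc j i)))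

  shiftedRowSum-suc : ∀ n j →
    shiftedRowSum (suc (suc n)) j ≡ g (j ℕ.+ 1) ℕ.* shiftedRowSum (suc n) 0 ℕ.+ shiftedRowSum (suc n) (suc j)
  shiftedRowSum-suc n j = begin
    sum (map (shiftedWeight j) (concatMap children (row (suc n))))
      ≡⟨ sum-map-concatMap (shiftedWeight j) children (row (suc n)) ⟩
    sum (map (λ w → sum (map (shiftedWeight j) (children w))) (row (suc n)))
      ≡⟨ cong sum (List.map-cong (shiftedWeight-children j) (row (suc n))) ⟩
    sum (map (λ w → g (j ℕ.+ 1) ℕ.* shiftedWeight 0 w ℕ.+ shiftedWeight (suc j) w) (row (suc n)))
      ≡⟨ sum-map-+ _ (shiftedWeight (suc j)) (row (suc n)) ⟩
    sum (map (λ w → g (j ℕ.+ 1) ℕ.* shiftedWeight 0 w) (row (suc n))) ℕ.+ shiftedRowSum (suc n) (suc j)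
      ≡⟨ cong (ℕ._+ shiftedRowSum (suc n) (suc j))
              (sum-map-*ˡ (g (j ℕ.+ 1)) (shiftedWeight 0) (row (suc n))) ⟩
    g (j ℕ.+ 1) ℕ.* shiftedRowSum (suc n) 0 ℕ.+ shiftedRowSum (suc n) (suc j) ∎

  rowSum≡shiftedRowSum : ∀ n → rowSum g (suc n) ≡ shiftedRowSum (suc n) 0
  rowSum≡shiftedRowSum zero    = refl
  rowSum≡shiftedRowSum (suc n) =
    trans (sum-map-concatMap _ children (row (suc n)))
          (trans (cong sum (List.map-cong childWeights (row (suc n))))
                 (sym (sum-map-concatMap _ children (row (suc n)))))
    where
    childWeights : ∀ w →
      sum (map (product ∘ map g) (children w)) ≡ sum (map (shiftedWeight 0) (children w))
    childWeights []      = refl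
    childWeights (_ ∷ _) = refl

  shiftedRowSum-convolution : ∀ n j →
    + shiftedRowSum (suc n) j ≡ ∑ (suc n) (λ k → + g (j ℕ.+ suc k) * rowSeries (n ∸ k))
  shiftedRowSum-convolution zero    j = +-*-+ (g (j ℕ.+ 1)) 1 0
  shiftedRowSum-convolution (suc n) j = begin
    + shiftedRowSum (suc (suc n)) j
      ≡⟨ cong +_ (shiftedRowSum-suc n j) ⟩
    + (g (j ℕ.+ 1) ℕ.* shiftedRowSum (suc n) 0 ℕ.+ shiftedRowSum (suc n) (suc j))
      ≡⟨ +-*-+ (g (j ℕ.+ 1)) _ _ ⟩
    + g (j ℕ.+ 1) * + shiftedRowSum (suc n) 0 + + shiftedRowSum (suc n) (suc j)
      ≡⟨ cong₂ _+_ (cong (λ t → + g (j ℕ.+ 1) * + t) (sym (rowSum≡shiftedRowSum n)))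
                   (shiftedRowSum-convolution n (suc j)) ⟩
    + g (j ℕ.+ 1) * rowSeries (suc n) + ∑ (suc n) (λ k → + g (suc j ℕ.+ suc k) * rowSeries (n ∸ k))
      ≡⟨ cong (_+_ (+ g (j ℕ.+ 1) * rowSeries (suc n))) (∑-cong (suc n) (λ k _ →
           cong (λ t → + g t * rowSeries (n ∸ k)) (sym (ℕ.+-suc j (suc k))))) ⟩
    ∑ (suc (suc n)) (λ k → + g (j ℕ.+ suc k) * rowSeries (suc n ∸ k)) ∎

  rowSeries-recurrence : ConvolutionRecurrence (λ k → + g (suc k)) rowSeries
  rowSeries-recurrence .recurrence n =
    trans (cong +_ (rowSum≡shiftedRowSum n)) (shiftedRowSum-convolution n 0)

open PITree using (rowSeries-recurrence)

compositionSum : (ℕ → ℕ) → ℕ → ℕ → ℕ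
compositionSum f m n = sum (map (λ ks → product (map f ks)) (compositions m n))

compositionSum-suc : ∀ f m n →
  + compositionSum f (suc m) n ≡ ∑ n (λ i → + f (suc i) * + compositionSum f m (n ∸ suc i))
compositionSum-suc f m n = begin
  + sum (map weight (concatMap (λ k → map (k ∷_) (compositions m (n ∸ k))) (oneTo n)))
    ≡⟨ cong +_ (sum-map-concatMap weight _ (oneTo n)) ⟩
  + sum (map (λ k → sum (map weight (map (k ∷_) (compositions m (n ∸ k))))) (oneTo n))
    ≡⟨ cong (+_ ∘ sum) (List.map-cong firstPart (oneTo n)) ⟩
  + sum (map (λ k → f k ℕ.* compositionSum f m (n ∸ k)) (oneTo n))
    ≡⟨ +-sum-map-oneTo _ n ⟩
  ∑ n (λ i → + (f (suc i) ℕ.* compositionSum f m (n ∸ suc i)))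
    ≡⟨ ∑-cong n (λ i _ → ℤ.pos-* (f (suc i)) _) ⟩
  ∑ n (λ i → + f (suc i) * + compositionSum f m (n ∸ suc i)) ∎
  where
  weight : List ℕ → ℕ
  weight ks = product (map f ks)

  firstPart : ∀ k →
    sum (map weight (map (k ∷_) (compositions m (n ∸ k)))) ≡ f k ℕ.* compositionSum f m (n ∸ k)
  firstPart k = trans (cong sum (sym (List.map-∘ (compositions m (n ∸ k)))))
                      (sum-map-*ˡ (f k) weight (compositions m (n ∸ k)))

compositionSum-vanishes : ∀ f {m n} → n ℕ.< m → + compositionSum f m n ≡ 0ℤ
compositionSum-vanishes f {suc m} {n} (s≤s n≤m) =
  trans (compositionSum-suc f m n) (∑-zero n (λ i i<n →
    trans (cong (+ f (suc i) *_) (compositionSum-vanishes f (smaller i<n)))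
          (ℤ.*-zeroʳ (+ f (suc i)))))
  where
  smaller : ∀ {i} → i ℕ.< n → n ∸ suc i ℕ.< m
  smaller {i} i<n = ℕ.≤-trans (ℕ.≤-reflexive (sym (∸-suc i<n))) (ℕ.≤-trans (ℕ.m∸n≤m n i) n≤m)

weightedCompositionSum : ℤ → (ℕ → ℕ) → ℕ → ℤ
weightedCompositionSum c f n = ∑ (suc n) (λ m → c ^ m * + compositionSum f m n)

weightedCompositionSum-suc : ∀ c f n →
  weightedCompositionSum c f (suc n) ≡ ∑ (suc n) (λ m → c ^ suc m * + compositionSum f (suc m) (suc n))
-- There is no composition of a positive number into 0 parts.
weightedCompositionSum-suc c f n = ℤ.+-identityˡ _

weightedCompositionSum-extend : ∀ c f {j n} → j ℕ.≤ n →
  ∑ (suc n) (λ m → c ^ m * + compositionSum f m j) ≡ weightedCompositionSum c f j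
weightedCompositionSum-extend c f {j} {n} j≤n = begin
  ∑ (suc n) term               ≡⟨ cong (λ t → ∑ (suc t) term) (sym (ℕ.m+[n∸m]≡n j≤n)) ⟩
  ∑ (suc j ℕ.+ (n ∸ j)) term   ≡⟨ ∑-vanishing-tail (suc j) (n ∸ j) term (λ m j<m →
                                    trans (cong (c ^ m *_) (compositionSum-vanishes f j<m)) (ℤ.*-zeroʳ (c ^ m))) ⟩
  ∑ (suc j) term               ∎
  where
  term : ℕ → ℤ
  term m = c ^ m * + compositionSum f m j

weightedCompositionSum-recurrence : ∀ c f →
  ConvolutionRecurrence (λ k → c * + f (suc k)) (weightedCompositionSum c f)
weightedCompositionSum-recurrence c f .recurrence n = begin
  weightedCompositionSum c f (suc n)
    ≡⟨ weightedCompositionSum-suc c f n ⟩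
  ∑ (suc n) (λ m → c ^ suc m * + compositionSum f (suc m) (suc n))
    ≡⟨ ∑-cong (suc n) (λ m _ → splitFirstPart m) ⟩
  ∑ (suc n) (λ m → ∑ (suc n) (λ k → a k * rest m k))
    ≡⟨ ∑-swap (suc n) (suc n) (λ m k → a k * rest m k) ⟩
  ∑ (suc n) (λ k → ∑ (suc n) (λ m → a k * rest m k))
    ≡⟨ ∑-cong (suc n) (λ k _ → trans (∑-*ˡ (suc n) (a k) (λ m → rest m k))
         (cong (a k *_) (weightedCompositionSum-extend c f (ℕ.m∸n≤m n k)))) ⟩
  ∑ (suc n) (λ k → a k * weightedCompositionSum c f (n ∸ k)) ∎
  where
  a : ℕ → ℤ
  a k = c * + f (suc k)

  rest : ℕ → ℕ → ℤ
  rest m k = c ^ m * + compositionSum f m (n ∸ k)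

  rearrange : ∀ c p a q → (c * p) * (a * q) ≡ (c * a) * (p * q)
  rearrange = solve-∀

  splitFirstPart : ∀ m → c ^ suc m * + compositionSum f (suc m) (suc n) ≡ ∑ (suc n) (λ k → a k * rest m k)
  splitFirstPart m = begin
    c ^ suc m * + compositionSum f (suc m) (suc n)
      ≡⟨ cong (c ^ suc m *_) (compositionSum-suc f m (suc n)) ⟩
    c ^ suc m * ∑ (suc n) (λ k → + f (suc k) * + compositionSum f m (n ∸ k))
      ≡⟨ sym (∑-*ˡ (suc n) (c ^ suc m) (λ k → + f (suc k) * + compositionSum f m (n ∸ k))) ⟩
    ∑ (suc n) (λ k → c ^ suc m * (+ f (suc k) * + compositionSum f m (n ∸ k)))
      ≡⟨ ∑-cong (suc n) (λ k _ → rearrange c (c ^ m) (+ f (suc k)) (+ compositionSum f m (n ∸ k))) ⟩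
    ∑ (suc n) (λ k → a k * rest m k) ∎

-- The coefficients of 1 - z C(z) = 1 / C(z).
catalanReciprocal : ℕ → ℤ
catalanReciprocal zero    = 1ℤ
catalanReciprocal (suc n) = - + catalan n

catalanReciprocal-recurrence :
  ConvolutionRecurrence (λ k → -1ℤ * + catalan (suc k)) catalanReciprocal
catalanReciprocal-recurrence .recurrence n = sym (begin
  ∑ (suc n) term
    ≡⟨ ∑-last n term ⟩
  ∑ n term + term n
    ≡⟨ cong₂ _+_ (∑-cong n (λ k k<n → cong (λ t → a k * catalanReciprocal t) (∸-suc k<n)))
                 (cong (λ t → a n * catalanReciprocal t) (ℕ.n∸n≡0 n)) ⟩
  ∑ n (λ k → (-1ℤ * + catalan (suc k)) * - + catalan (n ∸ suc k)) + (-1ℤ * + catalan (suc n)) * 1ℤ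
    -- C_{n+1} = C₀ C_n + rest, so the last term cancels the sum.
    ≡⟨ cong₂ _+_ (∑-cong n (λ k _ → negate-twice (+ catalan (suc k)) (+ catalan (n ∸ suc k))))
                 (cong (λ t → (-1ℤ * t) * 1ℤ) (recurrence catalan-recurrence n)) ⟩
  rest + (-1ℤ * (1ℤ * + catalan n + rest)) * 1ℤ
    ≡⟨ cancel rest (+ catalan n) ⟩
  - + catalan n ∎)
  where
  a : ℕ → ℤ
  a k = -1ℤ * + catalan (suc k)

  term : ℕ → ℤ
  term k = a k * catalanReciprocal (n ∸ k)

  rest : ℤ
  rest = ∑ n (λ k → + catalan (suc k) * + catalan (n ∸ suc k))

  negate-twice : ∀ a b → (-1ℤ * a) * - b ≡ a * b
  negate-twice = solve-∀

  cancel : ∀ s c → s + (-1ℤ * (1ℤ * c + s)) * 1ℤ ≡ - c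
  cancel = solve-∀

firstSum-weighted : ∀ n → + firstSum (suc n) ≡ weightedCompositionSum 1ℤ (λ k → catalan (k ∸ 1)) (suc n)
firstSum-weighted n = begin
  + firstSum (suc n)
    ≡⟨ +-sum-map-oneTo (λ m → compositionSum g m (suc n)) (suc n) ⟩
  ∑ (suc n) (λ m → + compositionSum g (suc m) (suc n))
    ≡⟨ ∑-cong (suc n) (λ m _ →
         sym (trans (cong (_* parts m) (ℤ.^-zeroˡ (suc m))) (ℤ.*-identityˡ (parts m)))) ⟩
  ∑ (suc n) (λ m → 1ℤ ^ suc m * + compositionSum g (suc m) (suc n))
    ≡⟨ sym (weightedCompositionSum-suc 1ℤ g n) ⟩
  weightedCompositionSum 1ℤ g (suc n) ∎
  where
  g : ℕ → ℕ
  g k = catalan (k ∸ 1)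

  parts : ℕ → ℤ
  parts m = + compositionSum g (suc m) (suc n)

secondSum-weighted : ∀ n → secondSum (suc n) ≡ -1ℤ * weightedCompositionSum -1ℤ catalan (suc n)
secondSum-weighted n = begin
  secondSum (suc n)
    ≡⟨ sumℤ-map-oneTo (λ m → -1ℤ ^ (m ℕ.+ 1) * + compositionSum catalan m (suc n)) (suc n) ⟩
  ∑ (suc n) (λ m → -1ℤ ^ (suc m ℕ.+ 1) * + compositionSum catalan (suc m) (suc n))
    ≡⟨ ∑-cong (suc n) (λ m _ → trans (cong (λ e → -1ℤ ^ e * parts m) (ℕ.+-comm (suc m) 1))
                                     (ℤ.*-assoc -1ℤ (-1ℤ ^ suc m) (parts m))) ⟩
  ∑ (suc n) (λ m → -1ℤ * (-1ℤ ^ suc m * + compositionSum catalan (suc m) (suc n)))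
    ≡⟨ ∑-*ˡ (suc n) -1ℤ (λ m → -1ℤ ^ suc m * parts m) ⟩
  -1ℤ * ∑ (suc n) (λ m → -1ℤ ^ suc m * + compositionSum catalan (suc m) (suc n))
    ≡⟨ cong (-1ℤ *_) (sym (weightedCompositionSum-suc -1ℤ catalan n)) ⟩
  -1ℤ * weightedCompositionSum -1ℤ catalan (suc n) ∎
  where
  parts : ℕ → ℤ
  parts m = + compositionSum catalan (suc m) (suc n)

rowSum-catalan : ∀ n → rowSum (λ i → catalan (i ∸ 1)) (suc n) ≡ catalan (suc n)
rowSum-catalan n = ℤ.+-injective
  (convolution-unique (λ _ → refl) refl
    (rowSeries-recurrence (λ i → catalan (i ∸ 1))) catalan-recurrence (suc n))

firstSum-catalan : ∀ n → catalan (suc n) ≡ firstSum (suc n)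
firstSum-catalan n = ℤ.+-injective (begin
  + catalan (suc n)
    ≡⟨ convolution-unique (λ k → sym (ℤ.*-identityˡ (+ catalan k))) refl
         catalan-recurrence (weightedCompositionSum-recurrence 1ℤ _) (suc n) ⟩
  weightedCompositionSum 1ℤ (λ k → catalan (k ∸ 1)) (suc n)
    ≡⟨ sym (firstSum-weighted n) ⟩
  + firstSum (suc n) ∎)

secondSum-catalan : ∀ n → + catalan n ≡ secondSum (suc n)
secondSum-catalan n = sym (begin
  secondSum (suc n)
    ≡⟨ secondSum-weighted n ⟩
  -1ℤ * weightedCompositionSum -1ℤ catalan (suc n)
    ≡⟨ cong (-1ℤ *_) (convolution-unique (λ _ → refl) refl
         (weightedCompositionSum-recurrence -1ℤ catalan) catalanReciprocal-recurrence (suc n)) ⟩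
  -1ℤ * - + catalan n
    ≡⟨ trans (ℤ.-1*i≡-i _) (ℤ.neg-involutive _) ⟩
  + catalan n ∎)

theorem7 : (n : ℕ) → 1 Data.Nat.≤ n →
    (rowSum (λ i → catalan (i ∸ 1)) n ≡ catalan n)
    × (catalan n ≡ firstSum n)
    × (+ catalan (n ∸ 1) ≡ secondSum n)
theorem7 (suc n) _ = rowSum-catalan n , firstSum-catalan n , secondSum-catalan n
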